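{- Let $P$ be a poset such that $\{q\in P: q\le p\}$ is finite for every $p\in P$. Let $(A_p)_{p\in P}$ and $(B_p)_{p\in P}$ be families of finite sets, and write $A_{\le p}=\sum_{q\le p}A_q$ and $B_{\le p}=\sum_{q\le p}B_q$ (disjoint unions). If for every $p\in P$ there is a bijection $A_{\le p}\to B_{\le p}$, then for every $p\in P$ there is a bijection $A_p\to B_p$.
   Context: $\sum$ denotes disjoint union. -}

module Defs where

open import Data.Nat using (ℕ)
open import Data.Fin using (Fin)
open import Data.Product using (Σ; proj₁)
open import Function.Bundles using (_↔_)
open import Relation.Binary.PropositionalEquality using (_≡_)
open import Relation.Binary.Structures using (IsPartialOrder)

IsFinite : Set → Set
IsFinite X = Σ ℕ λ n → X ↔ Fin n

record PosetStr (P : Set) : Set₁ where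
  field
    _≤_ : P → P → Set
    isPartialOrder : IsPartialOrder _≡_ _≤_
    ≤-prop : ∀ {x y} (a b : x ≤ y) → a ≡ b

Down : {P : Set} → PosetStr P → P → Set
Down {P} S p = Σ P λ q → PosetStr._≤_ S q p

SumBelow : {P : Set} → PosetStr P → (P → Set) → P → Set
SumBelow S A p = Σ (Down S p) λ qh → A (proj₁ qh)

-- Counting: |A_{≤p}| = Σ_{q≤p} |A_q|, so the hypothesis says the functions
-- p ↦ |A_p| and p ↦ |B_p| have the same sums over every down-set. Finite
-- down-sets make the strict order well-founded, and by induction all terms of
-- the sum over {q ≤ p} except the top one agree; cancelling them gives
-- |A_p| = |B_p|, and finite sets of equal size are in bijection.
module Submission where

open import Defs
open import Data.Fin using (Fin; zero; suc; punchOut; punchIn)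
open import Data.Fin.Permutation using (↔⇒≡)
open import Data.Fin.Properties using (+↔⊎; injective⇒≤; punchOut-injective; punchInᵢ≢i)
open import Data.Nat as ℕ using (ℕ; _+_; s≤s)
open import Data.Nat.Induction using (<-wellFounded)
open import Data.Nat.Properties using (+-cancelʳ-≡; +-0-commutativeMonoid)
open import Algebra.Properties.CommutativeMonoid.Sum +-0-commutativeMonoid using (sum; sum-remove; sum-cong-≗)
open import Data.Product using (Σ; _×_; _,_; proj₁; proj₂)
import Data.Product.Function.Dependent.Propositional as Σ
open import Data.Sum using (_⊎_; inj₁; inj₂)
open import Data.Sum.Function.Propositional using (_⊎-cong_)
open import Data.Vec.Functional using (Vector; removeAt)
open import Function using (_∘_)
open import Function.Bundles using (_↔_; Inverse; Injection; mk↔ₛ′)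
open import Function.Definitions using (Injective)
open import Function.Properties.Inverse using (↔-refl; ↔-sym; ↔-trans; ↔⇒↣)
open import Induction.WellFounded using (WellFounded; Acc; acc; module Subrelation)
import Relation.Binary.Construct.On as On
open import Relation.Binary.PropositionalEquality
  using (_≡_; _≢_; _≗_; refl; sym; trans; cong; subst; module ≡-Reasoning)
open import Relation.Binary.Structures using (IsPartialOrder)

Σ-Fin-suc↔⊎ : ∀ {n} (F : Fin (ℕ.suc n) → Set) → Σ (Fin (ℕ.suc n)) F ↔ (F zero ⊎ Σ (Fin n) (F ∘ suc))
Σ-Fin-suc↔⊎ F = mk↔ₛ′ split join (λ { (inj₁ x) → refl ; (inj₂ (i , x)) → refl })
                                 (λ { (zero , x) → refl ; (suc i , x) → refl })
  where
  split : Σ _ F → F zero ⊎ Σ _ (F ∘ suc)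
  split (zero , x) = inj₁ x
  split (suc i , x) = inj₂ (i , x)
  join : F zero ⊎ Σ _ (F ∘ suc) → Σ _ F
  join (inj₁ x) = zero , x
  join (inj₂ (i , x)) = suc i , x

Σ-Fin↔Fin-sum : ∀ {n} (f : Vector ℕ n) → Σ (Fin n) (Fin ∘ f) ↔ Fin (sum f)
Σ-Fin↔Fin-sum {ℕ.zero} f = mk↔ₛ′ (λ { (() , _) }) (λ ()) (λ ()) (λ { (() , _) })
Σ-Fin↔Fin-sum {ℕ.suc n} f =
  ↔-trans (Σ-Fin-suc↔⊎ (Fin ∘ f)) (↔-trans (↔-refl ⊎-cong Σ-Fin↔Fin-sum (f ∘ suc)) (↔-sym +↔⊎))

sum-cancel : ∀ {n} (f g : Vector ℕ n) i →
  sum f ≡ sum g → (∀ j → j ≢ i → f j ≡ g j) → f i ≡ g i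
sum-cancel {ℕ.zero} _ _ () _ _
sum-cancel {ℕ.suc _} f g i Σf≡Σg others = +-cancelʳ-≡ (sum (removeAt f i)) (f i) (g i) (begin
  f i + sum (removeAt f i)  ≡⟨ sum-remove f ⟨
  sum f                     ≡⟨ Σf≡Σg ⟩
  sum g                     ≡⟨ sum-remove g ⟩
  g i + sum (removeAt g i)  ≡⟨ cong (g i +_) (sum-cong-≗ rest) ⟨
  g i + sum (removeAt f i)  ∎)
  where
  open ≡-Reasoning
  rest : removeAt f i ≗ removeAt g i
  rest j = others (punchIn i j) (punchInᵢ≢i i j)

injective-avoiding⇒< : ∀ {m n} {f : Fin m → Fin n} (i : Fin n) →
  Injective _≡_ _≡_ f → (∀ j → f j ≢ i) → m ℕ.< n
injective-avoiding⇒< {n = ℕ.zero} () _ _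
injective-avoiding⇒< {n = ℕ.suc _} {f} i f-inj f≢i = s≤s (injective⇒≤ {f = f′} f′-inj)
  where
  f′ : Fin _ → Fin _
  f′ j = punchOut (f≢i j ∘ sym)
  f′-inj : Injective _≡_ _≡_ f′
  f′-inj {x} {y} = f-inj ∘ punchOut-injective (f≢i x ∘ sym) (f≢i y ∘ sym)

module FiniteDownSets {P : Set} (S : PosetStr P) (finite-Down : ∀ p → IsFinite (Down S p)) where

  open PosetStr S using (≤-prop) renaming (_≤_ to _⊑_)
  open IsPartialOrder (PosetStr.isPartialOrder S)
    using () renaming (refl to ⊑-refl; trans to ⊑-trans; antisym to ⊑-antisym)

  _⊏_ : P → P → Set
  q ⊏ p = q ⊑ p × q ≢ p

  size : P → ℕ
  size p = proj₁ (finite-Down p)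

  enum : ∀ p → Down S p ↔ Fin (size p)
  enum p = proj₂ (finite-Down p)

  element : ∀ p → Fin (size p) → P
  element p = proj₁ ∘ Inverse.from (enum p)

  top : ∀ p → Down S p
  top p = p , ⊑-refl

  Down-≡ : ∀ {p q q′} {h : q ⊑ p} {h′ : q′ ⊑ p} → q ≡ q′ → (q , h) ≡ (q′ , h′)
  Down-≡ {h = h} {h′} refl = cong (_ ,_) (≤-prop h h′)

  index-top : ∀ p → Fin (size p)
  index-top p = Inverse.to (enum p) (top p)

  index-injective : ∀ p → Injective _≡_ _≡_ (Inverse.to (enum p))
  index-injective p = Injection.injective (↔⇒↣ (enum p))

  size-mono-⊏ : ∀ {q p} → q ⊏ p → size q ℕ.< size p
  size-mono-⊏ {q} {p} (q⊑p , q≢p) = injective-avoiding⇒< (index-top p) ι-injective ι≢top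
    where
    widen : Down S q → Down S p
    widen (r , r⊑q) = r , ⊑-trans r⊑q q⊑p
    ι : Fin (size q) → Fin (size p)
    ι = Inverse.to (enum p) ∘ widen ∘ Inverse.from (enum q)
    ι-injective : Injective _≡_ _≡_ ι
    ι-injective = Injection.injective (↔⇒↣ (↔-sym (enum q))) ∘ Down-≡ ∘ cong proj₁ ∘ index-injective p
    ι≢top : ∀ j → ι j ≢ index-top p
    ι≢top j eq with Inverse.from (enum q) j | cong proj₁ (index-injective p eq)
    ... | r , r⊑q | refl = q≢p (⊑-antisym q⊑p r⊑q)

  ⊏-wellFounded : WellFounded _⊏_
  ⊏-wellFounded = Subrelation.wellFounded size-mono-⊏ (On.wellFounded size <-wellFounded)

  element-top : ∀ p → element p (index-top p) ≡ p
  element-top p = cong proj₁ (Inverse.strictlyInverseʳ (enum p) (top p))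

  element-⊏ : ∀ p i → i ≢ index-top p → element p i ⊏ p
  element-⊏ p i i≢top = proj₂ (Inverse.from (enum p) i) , λ eq →
    i≢top (trans (sym (Inverse.strictlyInverseˡ (enum p) i)) (cong (Inverse.to (enum p)) (Down-≡ eq)))

  sumBelow : (P → ℕ) → P → ℕ
  sumBelow f p = sum (f ∘ element p)

  sumBelow-injective : ∀ {f g : P → ℕ} → (∀ p → sumBelow f p ≡ sumBelow g p) → ∀ p → f p ≡ g p
  sumBelow-injective {f} {g} Σf≡Σg p = go p (⊏-wellFounded p)
    where
    go : ∀ p → Acc _⊏_ p → f p ≡ g p
    go p (acc below) = subst (λ r → f r ≡ g r) (element-top p)
      (sum-cancel (f ∘ element p) (g ∘ element p) (index-top p) (Σf≡Σg p)
        (λ i i≢top → go _ (below (element-⊏ p i i≢top))))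

  -- Reindexing along the inverse of enum p makes the fibres match definitionally.
  SumBelow↔Fin-sumBelow : ∀ {C : P → Set} {c : P → ℕ} → (∀ p → C p ↔ Fin (c p)) →
    ∀ p → SumBelow S C p ↔ Fin (sumBelow c p)
  SumBelow↔Fin-sumBelow {C} {c} C↔c p =
    ↔-trans (↔-sym (Σ.cong {B = C ∘ proj₁} (↔-sym (enum p)) ↔-refl))
            (↔-trans (Σ.congˡ (λ {i} → C↔c (element p i))) (Σ-Fin↔Fin-sum (c ∘ element p)))

proposition7 : (P : Set) (S : PosetStr P)
    → (∀ p → IsFinite (Down S p))
    → (A B : P → Set)
    → (∀ p → IsFinite (A p))
    → (∀ p → IsFinite (B p))
    → (∀ p → SumBelow S A p ↔ SumBelow S B p)
    → ∀ p → A p ↔ B p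
proposition7 P S finite-Down A B finite-A finite-B A≤↔B≤ p =
  ↔-trans (A↔Fin p) (subst (λ n → Fin n ↔ B p) (sym (|A|≡|B| p)) (↔-sym (B↔Fin p)))
  where
  open FiniteDownSets S finite-Down
  |A| |B| : P → ℕ
  |A| = proj₁ ∘ finite-A
  |B| = proj₁ ∘ finite-B
  A↔Fin : ∀ p → A p ↔ Fin (|A| p)
  A↔Fin = proj₂ ∘ finite-A
  B↔Fin : ∀ p → B p ↔ Fin (|B| p)
  B↔Fin = proj₂ ∘ finite-B
  sums-equal : ∀ p → sumBelow |A| p ≡ sumBelow |B| p
  sums-equal p = ↔⇒≡ (↔-trans (↔-sym (SumBelow↔Fin-sumBelow A↔Fin p))
                              (↔-trans (A≤↔B≤ p) (SumBelow↔Fin-sumBelow B↔Fin p)))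
  |A|≡|B| : ∀ p → |A| p ≡ |B| p
  |A|≡|B| = sumBelow-injective sums-equal
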